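{- Let $M\models\textup{DOAG}$ and let $A\subseteq M$ be a $\mathbb{Q}$-vector subspace such that $M$ is $|A|^+$-saturated and strongly $|A|^+$-homogeneous. For all $d_1,d_2\in M$, we have $G(d_1+d_2/A)\subseteq\max\big(G(d_1/A),G(d_2/A)\big)$, the maximum being taken with respect to inclusion.
   Context: For $d\in M$, the cut $\textup{ct}(d/A)$ is the intersection of all intervals of $M$ containing $d$ with endpoints in $A\cup\{\pm\infty\}$. The group $A$ acts on cuts by translation, and $\textup{Stab}(d/A)=\{a\in A:\textup{ct}(d+a/A)=\textup{ct}(d/A)\}$. If $d\notin A$, $G(d/A)=\bigcap\{\,]-|a|,|a|[\,: a\in A\setminus\textup{Stab}(d/A)\}$; if $d\in A$, $G(d/A)=\{0\}$. These are convex subgroups of $M$ (hence totally ordered by inclusion), viewed as sets of points of $M$. -}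

module Defs where

open import Level using (0ℓ)
open import Data.Nat using (ℕ; zero; suc)
open import Data.Fin using (Fin)
open import Data.Product using (Σ; Σ-syntax; ∃; _×_; _,_; proj₁)
open import Data.Sum using (_⊎_)
open import Data.Empty using (⊥; ⊥-elim)
open import Data.List using (List)
open import Data.List.Relation.Unary.All using (All)
open import Data.Vec.Functional using (_∷_)
open import Relation.Nullary using (¬_)
open import Relation.Unary using (Pred; _⊆_)
open import Relation.Binary.PropositionalEquality using (_≡_)
open import Relation.Binary using (IsStrictTotalOrder; Tri; tri<; tri≈; tri>)
open import Algebra.Structures using (IsAbelianGroup)
open import Function using (_∘_; _⇔_)

times : {C : Set} → (C → C → C) → C → ℕ → C → C
times _+_ 0# zero    x = 0#
times _+_ 0# (suc n) x = x + times _+_ 0# n x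

record DOAG : Set₁ where
  infixl 6 _+_
  infix 4 _<_
  field
    Carrier : Set
    _+_     : Carrier → Carrier → Carrier
    0#      : Carrier
    -_      : Carrier → Carrier
    _<_     : Carrier → Carrier → Set
    isAbelianGroup    : IsAbelianGroup _≡_ _+_ 0# -_
    isStrictTotalOrder : IsStrictTotalOrder _≡_ _<_
    +-mono-<          : ∀ {x y} z → x < y → x + z < y + z
    nontrivial        : ∃ λ x → 0# < x

    divisible : ∀ n x → ∃ λ y → times _+_ 0# (suc n) y ≡ x

  _·_ : ℕ → Carrier → Carrier
  _·_ = times _+_ 0#

  _≤_ : Carrier → Carrier → Set
  x ≤ y = x < y ⊎ x ≡ y

  ∣_∣ : Carrier → Carrier
  ∣ a ∣ with IsStrictTotalOrder.compare isStrictTotalOrder a 0#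
  ... | tri< _ _ _ = - a
  ... | tri≈ _ _ _ = a
  ... | tri> _ _ _ = a

-- First-order formulas of the language {+, -, 0, <} with parameters
-- from a set P and n free variables (de Bruijn indices Fin n).

data Term (P : Set) (n : ℕ) : Set where
  var  : Fin n → Term P n
  par  : P → Term P n
  zer  : Term P n
  _⊕_  : Term P n → Term P n → Term P n
  ⊖_   : Term P n → Term P n

data Formula (P : Set) : ℕ → Set where
  _≐_  : ∀ {n} → Term P n → Term P n → Formula P n
  _≺_  : ∀ {n} → Term P n → Term P n → Formula P n
  ¬'_  : ∀ {n} → Formula P n → Formula P n
  _∧'_ : ∀ {n} → Formula P n → Formula P n → Formula P n
  ∃'_  : ∀ {n} → Formula P (suc n) → Formula P n

module Semantics (M : DOAG) where
  open DOAG M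

  eval : ∀ {P n} → (P → Carrier) → (Fin n → Carrier) → Term P n → Carrier
  eval ι ρ (var i) = ρ i
  eval ι ρ (par p) = ι p
  eval ι ρ zer     = 0#
  eval ι ρ (s ⊕ t) = eval ι ρ s + eval ι ρ t
  eval ι ρ (⊖ t)   = - eval ι ρ t

  Sat : ∀ {P n} → (P → Carrier) → (Fin n → Carrier) → Formula P n → Set
  Sat ι ρ (s ≐ t)  = eval ι ρ s ≡ eval ι ρ t
  Sat ι ρ (s ≺ t)  = eval ι ρ s < eval ι ρ t
  Sat ι ρ (¬' φ)   = ¬ Sat ι ρ φ
  Sat ι ρ (φ ∧' ψ) = Sat ι ρ φ × Sat ι ρ ψ
  Sat ι ρ (∃' φ)   = Σ Carrier λ c → Sat ι (c ∷ ρ) φ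

  Sub : Pred Carrier 0ℓ → Set
  Sub B = Σ Carrier B

  -- |B| ≤ |A|  (equivalently |B| < |A|⁺): an injection B ↪ A
  _≼_ : Pred Carrier 0ℓ → Pred Carrier 0ℓ → Set
  B ≼ A = Σ (Sub B → Sub A) λ f →
            ∀ u v → proj₁ (f u) ≡ proj₁ (f v) → proj₁ u ≡ proj₁ v

  Realizes : {B : Pred Carrier 0ℓ} → Carrier → Formula (Sub B) 1 → Set
  Realizes m φ = Sat proj₁ (λ _ → m) φ

  FinSat : {B : Pred Carrier 0ℓ} → Pred (Formula (Sub B) 1) 0ℓ → Set
  FinSat p = ∀ (l : List _) → All p l → ∃ λ m → All (Realizes m) l

  Saturated : Pred Carrier 0ℓ → Set₁
  Saturated A = ∀ (B : Pred Carrier 0ℓ) → B ≼ A →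
    (p : Pred (Formula (Sub B) 1) 0ℓ) → FinSat p →
    ∃ λ m → ∀ φ → p φ → Realizes m φ

  Elementary : (B : Pred Carrier 0ℓ) → (Sub B → Carrier) → Set
  Elementary B f = ∀ n (φ : Formula ⊥ n) (b : Fin n → Sub B) →
    Sat ⊥-elim (proj₁ ∘ b) φ ⇔ Sat ⊥-elim (f ∘ b) φ

  record Automorphism : Set where
    field
      σ      : Carrier → Carrier
      σ⁻¹    : Carrier → Carrier
      left   : ∀ x → σ⁻¹ (σ x) ≡ x
      right  : ∀ x → σ (σ⁻¹ x) ≡ x
      hom-+  : ∀ x y → σ (x + y) ≡ σ x + σ y
      pres-< : ∀ x y → x < y ⇔ σ x < σ y

  StronglyHomogeneous : Pred Carrier 0ℓ → Set₁
  StronglyHomogeneous A = ∀ (B : Pred Carrier 0ℓ) → B ≼ A →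
    (f : Sub B → Carrier) → Elementary B f →
    Σ Automorphism λ τ → ∀ b → Automorphism.σ τ (proj₁ b) ≡ f b

  -- Q-vector subspaces (= divisible subgroups)
  record IsQSubspace (A : Pred Carrier 0ℓ) : Set where
    field
      has-0  : A 0#
      has-+  : ∀ {x y} → A x → A y → A (x + y)
      has--  : ∀ {x} → A x → A (- x)
      has-÷  : ∀ n {x y} → suc n · y ≡ x → A x → A y

  data Lower : Set where
    -∞    : Lower
    ≥[_]  : Carrier → Lower
    >]_[  : Carrier → Lower

  data Upper : Set where
    +∞    : Upper
    ≤[_]  : Carrier → Upper
    <]_[  : Carrier → Upper

  AboveL : Lower → Carrier → Set
  AboveL -∞      x = Data.Unit.⊤ where import Data.Unit
  AboveL ≥[ a ]  x = a ≤ x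
  AboveL >] a [  x = a < x

  BelowU : Upper → Carrier → Set
  BelowU +∞      x = Data.Unit.⊤ where import Data.Unit
  BelowU ≤[ a ]  x = x ≤ a
  BelowU <] a [  x = x < a

  LowerIn : Pred Carrier 0ℓ → Lower → Set
  LowerIn A -∞      = Data.Unit.⊤ where import Data.Unit
  LowerIn A ≥[ a ]  = A a
  LowerIn A >] a [  = A a

  UpperIn : Pred Carrier 0ℓ → Upper → Set
  UpperIn A +∞      = Data.Unit.⊤ where import Data.Unit
  UpperIn A ≤[ a ]  = A a
  UpperIn A <] a [  = A a

  InInterval : Lower → Upper → Carrier → Set
  InInterval l u x = AboveL l x × BelowU u x

  -- ct(d/A), as a set of points of M
  ct : Pred Carrier 0ℓ → Carrier → Pred Carrier 0ℓ
  ct A d x = ∀ (l : Lower) (u : Upper) → LowerIn A l → UpperIn A u →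
             InInterval l u d → InInterval l u x

  _≐ˢ_ : Pred Carrier 0ℓ → Pred Carrier 0ℓ → Set
  S ≐ˢ T = S ⊆ T × T ⊆ S

  Stab : Pred Carrier 0ℓ → Carrier → Pred Carrier 0ℓ
  Stab A d a = A a × (ct A (d + a) ≐ˢ ct A d)

  G : Pred Carrier 0ℓ → Carrier → Pred Carrier 0ℓ
  G A d x = (A d → x ≡ 0#) ×
            (¬ A d → ∀ a → A a → ¬ Stab A d a → (- ∣ a ∣ < x × x < ∣ a ∣))

  IsMaxIncl : Pred Carrier 0ℓ → Pred Carrier 0ℓ → Pred Carrier 0ℓ → Set
  IsMaxIncl S T Z = (Z ≐ˢ S ⊎ Z ≐ˢ T) × S ⊆ Z × T ⊆ Z

-- For d ∉ A and a ∈ A, translation by a moves the cut of d exactly when A has a point in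
-- ]d, d + |a|]; hence G(d/A) is the intersection of the intervals ]-p, p[ over those p ∈ A
-- for which ]d, d + p] meets A. If x lies outside G(d₁/A) and G(d₂/A), pick such p₁, p₂
-- witnessing it, halve them (a point of A in ]d, d + 2h] yields one in ]d, d + h]) and let h
-- be the larger half: then A has points c₁ ∈ ]d₁, d₁ + h] and c₂ ∈ ]d₂, d₂ + h], so
-- c₁ + c₂ ∈ ]d₁ + d₂, d₁ + d₂ + 2h] and x ∉ ]-2h, 2h[ ⊇ G(d₁ + d₂/A). When some dᵢ lies in A,
-- G is invariant under translation by A. Thus G(d₁ + d₂/A) ⊆ G(d₁/A) ∪ G(d₂/A), and both
-- are contained in their maximum.
module Submission where

open import Defs
open import Level using (0ℓ)
open import Relation.Unary using (Pred; _⊆_)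
open import Axiom.ExcludedMiddle using (ExcludedMiddle)
open import Axiom.DoubleNegationElimination using (em⇒dne)
open import Algebra.Bundles using (AbelianGroup)
open import Data.Empty using (⊥; ⊥-elim)
open import Data.Product using (∃; _×_; _,_; proj₁; proj₂; swap)
open import Data.Sum using (_⊎_; inj₁; inj₂; [_,_]′)
open import Data.Unit using (tt)
open import Relation.Binary using (IsStrictTotalOrder; tri<; tri≈; tri>)
open import Relation.Binary.Bundles using (StrictPartialOrder)
open import Relation.Binary.PropositionalEquality using (_≡_; _≢_; refl; sym; trans; cong; subst)
open import Relation.Nullary using (¬_; yes; no)
open import Function using (id)
import Algebra.Properties.AbelianGroup as AbelianGroupProperties
import Algebra.Properties.CommutativeSemigroup as CommutativeSemigroupProperties
import Relation.Binary.Reasoning.StrictPartialOrder as StrictReasoning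

module DOAGProperties (M : DOAG) where
  -- Defs leaves _≤_ at the default fixity 20, tighter than _+_.
  open DOAG M renaming (+-mono-< to +-monoˡ-<; _≤_ to infix 4 _≤_)
  open IsStrictTotalOrder isStrictTotalOrder public
    using (compare; irrefl; isStrictPartialOrder) renaming (trans to <-trans)

  abelianGroup : AbelianGroup 0ℓ 0ℓ
  abelianGroup = record { isAbelianGroup = isAbelianGroup }

  strictPartialOrder : StrictPartialOrder 0ℓ 0ℓ 0ℓ
  strictPartialOrder = record { isStrictPartialOrder = isStrictPartialOrder }

  open AbelianGroup abelianGroup public
    using (assoc; comm; identityˡ; identityʳ; inverseʳ; commutativeSemigroup)
  open AbelianGroupProperties abelianGroup public using (//-rightDividesʳ)
  open CommutativeSemigroupProperties commutativeSemigroup public using (interchange)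
  open StrictReasoning strictPartialOrder

  +-monoʳ-< : ∀ z {x y} → x < y → z + x < z + y
  +-monoʳ-< z {x} {y} x<y = begin-strict
    z + x  ≡⟨ comm z x ⟩
    x + z  <⟨ +-monoˡ-< z x<y ⟩
    y + z  ≡⟨ comm y z ⟩
    z + y  ∎

  +-monoˡ-≤ : ∀ z {x y} → x ≤ y → x + z ≤ y + z
  +-monoˡ-≤ z (inj₁ x<y)  = inj₁ (+-monoˡ-< z x<y)
  +-monoˡ-≤ z (inj₂ refl) = inj₂ refl

  +-monoʳ-≤ : ∀ z {x y} → x ≤ y → z + x ≤ z + y
  +-monoʳ-≤ z (inj₁ x<y)  = inj₁ (+-monoʳ-< z x<y)
  +-monoʳ-≤ z (inj₂ refl) = inj₂ refl

  +-mono-< : ∀ {x y u v} → x < y → u < v → x + u < y + v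
  +-mono-< {x} {y} {u} {v} x<y u<v = begin-strict
    x + u  <⟨ +-monoˡ-< u x<y ⟩
    y + u  <⟨ +-monoʳ-< y u<v ⟩
    y + v  ∎

  +-mono-≤ : ∀ {x y u v} → x ≤ y → u ≤ v → x + u ≤ y + v
  +-mono-≤ {x} {y} {u} {v} x≤y u≤v = begin
    x + u  ≤⟨ +-monoˡ-≤ u x≤y ⟩
    y + u  ≤⟨ +-monoʳ-≤ y u≤v ⟩
    y + v  ∎

  x<x+y : ∀ x {y} → 0# < y → x < x + y
  x<x+y x {y} 0<y = begin-strict
    x       ≡⟨ identityʳ x ⟨
    x + 0#  <⟨ +-monoʳ-< x 0<y ⟩
    x + y   ∎

  x<0⇒0<-x : ∀ {x} → x < 0# → 0# < - x
  x<0⇒0<-x {x} x<0 = begin-strict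
    0#        ≡⟨ inverseʳ x ⟨
    x + - x   <⟨ +-monoˡ-< (- x) x<0 ⟩
    0# + - x  ≡⟨ identityˡ (- x) ⟩
    - x       ∎

  0<x⇒-x<0 : ∀ {x} → 0# < x → - x < 0#
  0<x⇒-x<0 {x} 0<x = begin-strict
    - x       ≡⟨ identityˡ (- x) ⟨
    0# + - x  <⟨ +-monoˡ-< (- x) 0<x ⟩
    x + - x   ≡⟨ inverseʳ x ⟩
    0#        ∎

  0<x⇒∣x∣≡x : ∀ {x} → 0# < x → ∣ x ∣ ≡ x
  0<x⇒∣x∣≡x {x} 0<x with compare x 0#
  ... | tri< x<0 _ _ = ⊥-elim (irrefl refl (<-trans x<0 0<x))
  ... | tri≈ _ _ _   = refl
  ... | tri> _ _ _   = refl

  x≢0⇒0<∣x∣ : ∀ {x} → x ≢ 0# → 0# < ∣ x ∣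
  x≢0⇒0<∣x∣ {x} x≢0 with compare x 0#
  ... | tri< x<0 _ _ = x<0⇒0<-x x<0
  ... | tri≈ _ x≡0 _ = ⊥-elim (x≢0 x≡0)
  ... | tri> _ _ 0<x = 0<x

  x≤y+z⇒x-z≤y : ∀ {x y} z → x ≤ y + z → x + - z ≤ y
  x≤y+z⇒x-z≤y {x} {y} z x≤y+z = begin
    x + - z        ≤⟨ +-monoˡ-≤ (- z) x≤y+z ⟩
    y + z + - z    ≡⟨ //-rightDividesʳ z y ⟩
    y              ∎

  y+z<x⇒y<x-z : ∀ {x y} z → y + z < x → y < x + - z
  y+z<x⇒y<x-z {x} {y} z y+z<x = begin-strict
    y              ≡⟨ //-rightDividesʳ z y ⟨
    y + z + - z    <⟨ +-monoˡ-< (- z) y+z<x ⟩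
    x + - z        ∎

  halve : ∀ x → ∃ λ h → x ≡ h + h
  halve x with divisible 1 x
  ... | h , h+[h+0]≡x = h , trans (sym h+[h+0]≡x) (cong (h +_) (identityʳ h))

module Cuts (M : DOAG) (A : Pred (DOAG.Carrier M) 0ℓ) (A-subspace : Semantics.IsQSubspace M A) where
  open DOAG M renaming (Carrier to C; +-mono-< to +-monoˡ-<; _≤_ to infix 4 _≤_)
  open Semantics M
  open IsQSubspace A-subspace
  open DOAGProperties M
  open StrictReasoning strictPartialOrder

  ∣∣-closed : ∀ {a} → A a → A ∣ a ∣
  ∣∣-closed {a} a∈A with compare a 0#
  ... | tri< _ _ _ = has-- a∈A
  ... | tri≈ _ _ _ = a∈A
  ... | tri> _ _ _ = a∈A

  +-∉ : ∀ {d a} → ¬ A d → A a → ¬ A (d + a)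
  +-∉ {d} {a} d∉A a∈A d+a∈A = d∉A (subst A (//-rightDividesʳ a d) (has-+ d+a∈A (has-- a∈A)))

  AboveL-mono : ∀ l {x y} → x ≤ y → AboveL l x → AboveL l y
  AboveL-mono -∞     _   _   = tt
  AboveL-mono ≥[ a ] x≤y a≤x = begin a ≤⟨ a≤x ⟩ _ ≤⟨ x≤y ⟩ _ ∎
  AboveL-mono >] a [ x≤y a<x = begin-strict a <⟨ a<x ⟩ _ ≤⟨ x≤y ⟩ _ ∎

  BelowU-anti : ∀ u {x y} → x ≤ y → BelowU u y → BelowU u x
  BelowU-anti +∞     _   _   = tt
  BelowU-anti ≤[ a ] x≤y y≤a = begin _ ≤⟨ x≤y ⟩ _ ≤⟨ y≤a ⟩ a ∎
  BelowU-anti <] a [ x≤y y<a = begin-strict _ ≤⟨ x≤y ⟩ _ <⟨ y<a ⟩ a ∎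

  -- For d ∉ A and 0 < p, translation by p moves the cut of d iff Crosses d p
  -- (Crosses⇒¬Stab, ¬Crosses⇒ct-≐ˢ); this is how Stab(d/A) is handled throughout.
  Crosses : C → C → Set
  Crosses d p = ∃ λ c → A c × d < c × c ≤ d + p

  Within : C → C → Set
  Within p x = - p < x × x < p

  Crosses⇒¬Stab : ∀ {d p} → Crosses d p → ¬ Stab A d p
  Crosses⇒¬Stab {d} {p} (c , c∈A , d<c , c≤d+p) (_ , ct[d+p]⊆ct[d] , _) =
    irrefl refl (begin-strict c ≤⟨ c≤d+p ⟩ d + p <⟨ d+p<c ⟩ c ∎)
    where
    d+p<c : d + p < c
    d+p<c = proj₂ (ct[d+p]⊆ct[d] (λ _ _ _ _ i → i) -∞ <] c [ tt c∈A (tt , d<c))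

  Crosses⇒0< : ∀ {d p} → Crosses d p → 0# < p
  Crosses⇒0< {d} {p} (c , _ , d<c , c≤d+p) with compare p 0#
  ... | tri< p<0 _ _ = ⊥-elim (irrefl refl (begin-strict
          d      <⟨ d<c ⟩
          c      ≤⟨ c≤d+p ⟩
          d + p  <⟨ +-monoʳ-< d p<0 ⟩
          d + 0# ≡⟨ identityʳ d ⟩
          d      ∎))
  ... | tri≈ _ refl _ = ⊥-elim (irrefl refl (begin-strict
          d      <⟨ d<c ⟩
          c      ≤⟨ c≤d+p ⟩
          d + 0# ≡⟨ identityʳ d ⟩
          d      ∎))
  ... | tri> _ _ 0<p = 0<p

  Crosses-mono : ∀ {d p q} → p ≤ q → Crosses d p → Crosses d q
  Crosses-mono {d} {p} {q} p≤q (c , c∈A , d<c , c≤d+p) =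
    c , c∈A , d<c , (begin c ≤⟨ c≤d+p ⟩ d + p ≤⟨ +-monoʳ-≤ d p≤q ⟩ d + q ∎)

  Crosses-+ : ∀ {d₁ d₂ p q} → Crosses d₁ p → Crosses d₂ q → Crosses (d₁ + d₂) (p + q)
  Crosses-+ {d₁} {d₂} {p} {q} (c₁ , c₁∈A , d₁<c₁ , c₁≤d₁+p) (c₂ , c₂∈A , d₂<c₂ , c₂≤d₂+q) =
    c₁ + c₂ , has-+ c₁∈A c₂∈A , +-mono-< d₁<c₁ d₂<c₂ , (begin
      c₁ + c₂              ≤⟨ +-mono-≤ c₁≤d₁+p c₂≤d₂+q ⟩
      (d₁ + p) + (d₂ + q)  ≡⟨ interchange d₁ p d₂ q ⟩
      (d₁ + d₂) + (p + q)  ∎)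

  Crosses-translate : ∀ {d a p} → A a → Crosses d p → Crosses (d + a) p
  Crosses-translate {d} {a} {p} a∈A (c , c∈A , d<c , c≤d+p) =
    c + a , has-+ c∈A a∈A , +-monoˡ-< a d<c , (begin
      c + a        ≤⟨ +-monoˡ-≤ a c≤d+p ⟩
      d + p + a    ≡⟨ assoc d p a ⟩
      d + (p + a)  ≡⟨ cong (d +_) (comm p a) ⟩
      d + (a + p)  ≡⟨ assoc d a p ⟨
      d + a + p    ∎)

  -- If c ∈ A lies in ]d, d + 2h] but not in ]d, d + h], then c - h ∈ A lies in ]d, d + h].
  Crosses-halve : ∀ {d p} → A p → Crosses d p → ∃ λ h → A h × Crosses d h × p ≡ h + h
  Crosses-halve {d} {p} p∈A (c , c∈A , d<c , c≤d+p) with halve p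
  ... | h , p≡h+h = h , h∈A , crosses-h , p≡h+h
    where
    h∈A : A h
    h∈A = has-÷ 1 (trans (cong (h +_) (identityʳ h)) (sym p≡h+h)) p∈A
    crosses-h : Crosses d h
    crosses-h with compare c (d + h)
    ... | tri< c<d+h _ _ = c , c∈A , d<c , inj₁ c<d+h
    ... | tri≈ _ c≡d+h _ = c , c∈A , d<c , inj₂ c≡d+h
    ... | tri> _ _ d+h<c = c + - h , has-+ c∈A (has-- h∈A) , y+z<x⇒y<x-z h d+h<c ,
          x≤y+z⇒x-z≤y h (begin
            c            ≤⟨ c≤d+p ⟩
            d + p        ≡⟨ cong (d +_) p≡h+h ⟩
            d + (h + h)  ≡⟨ assoc d h h ⟨
            d + h + h    ∎)

  module _ {d p} (d∉A : ¬ A d) (0<p : 0# < p) (¬crosses : ¬ Crosses d p) where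

    ≤d+p⇒≤d : ∀ {a} → A a → a ≤ d + p → a ≤ d
    ≤d+p⇒≤d {a} a∈A a≤d+p with compare a d
    ... | tri< a<d _ _ = inj₁ a<d
    ... | tri≈ _ a≡d _ = inj₂ a≡d
    ... | tri> _ _ d<a = ⊥-elim (¬crosses (a , a∈A , d<a , a≤d+p))

    <a⇒d+p<a : ∀ {a} → A a → d < a → d + p < a
    <a⇒d+p<a {a} a∈A d<a with compare (d + p) a
    ... | tri< d+p<a _ _ = d+p<a
    ... | tri≈ _ d+p≡a _ = ⊥-elim (¬crosses (a , a∈A , d<a , inj₂ (sym d+p≡a)))
    ... | tri> _ _ a<d+p = ⊥-elim (¬crosses (a , a∈A , d<a , inj₁ a<d+p))

    AboveL-unshift : ∀ l → LowerIn A l → AboveL l (d + p) → AboveL l d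
    AboveL-unshift -∞     _   _     = tt
    AboveL-unshift ≥[ a ] a∈A a≤d+p = ≤d+p⇒≤d a∈A a≤d+p
    AboveL-unshift >] a [ a∈A a<d+p with ≤d+p⇒≤d a∈A (inj₁ a<d+p)
    ... | inj₁ a<d  = a<d
    ... | inj₂ refl = ⊥-elim (d∉A a∈A)

    BelowU-shift : ∀ u → UpperIn A u → BelowU u d → BelowU u (d + p)
    BelowU-shift +∞     _   _          = tt
    BelowU-shift ≤[ a ] a∈A (inj₁ d<a) = inj₁ (<a⇒d+p<a a∈A d<a)
    BelowU-shift ≤[ a ] a∈A (inj₂ refl) = ⊥-elim (d∉A a∈A)
    BelowU-shift <] a [ a∈A d<a        = <a⇒d+p<a a∈A d<a

    ¬Crosses⇒ct-≐ˢ : ct A (d + p) ≐ˢ ct A d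
    ¬Crosses⇒ct-≐ˢ =
      (λ x∈ct l u l∈A u∈A (l<d , d<u) →
        x∈ct l u l∈A u∈A (AboveL-mono l d≤d+p l<d , BelowU-shift u u∈A d<u)) ,
      (λ x∈ct l u l∈A u∈A (l<d+p , d+p<u) →
        x∈ct l u l∈A u∈A (AboveL-unshift l l∈A l<d+p , BelowU-anti u d≤d+p d+p<u))
      where
      d≤d+p : d ≤ d + p
      d≤d+p = inj₁ (x<x+y d 0<p)

  ¬Crosses-back : ∀ {d a} → ¬ A d → A a → ¬ Crosses d (- a) → ¬ Crosses (d + a) (- a)
  ¬Crosses-back {d} {a} d∉A a∈A ¬crosses (c , c∈A , d+a<c , c≤d+a-a)
    with subst (c ≤_) (//-rightDividesʳ a d) c≤d+a-a
  ... | inj₂ refl = d∉A c∈A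
  ... | inj₁ c<d  =
    ¬crosses (c + - a , has-+ c∈A (has-- a∈A) , y+z<x⇒y<x-z a d+a<c , inj₁ (+-monoˡ-< (- a) c<d))

  0∈Stab : ∀ d → Stab A d 0#
  0∈Stab d = has-0 , subst (λ y → ct A y ≐ˢ ct A d) (sym (identityʳ d)) (id , id)

  0∈G : ∀ d → G A d 0#
  0∈G d = (λ _ → refl) , λ _ a _ a∉Stab →
    let 0<∣a∣ = x≢0⇒0<∣x∣ (λ { refl → a∉Stab (0∈Stab d) }) in 0<x⇒-x<0 0<∣a∣ , 0<∣a∣

  G⇒Within : ∀ {d x p} → ¬ A d → G A d x → A p → Crosses d p → Within p x
  G⇒Within {d} {x} {p} d∉A x∈G p∈A crosses =
    subst (λ q → Within q x) (0<x⇒∣x∣≡x (Crosses⇒0< crosses))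
      (proj₂ x∈G d∉A p p∈A (Crosses⇒¬Stab crosses))

  G-+⇒Within : ∀ {d₁ d₂ x h} → ¬ A (d₁ + d₂) → G A (d₁ + d₂) x → A h →
               Crosses d₁ h → Crosses d₂ h → Within (h + h) x
  G-+⇒Within d₁+d₂∉A x∈G h∈A crosses₁ crosses₂ =
    G⇒Within d₁+d₂∉A x∈G (has-+ h∈A h∈A) (Crosses-+ crosses₁ crosses₂)

  module Classical (em : ExcludedMiddle 0ℓ) where

    ¬Stab⇒Crosses : ∀ {d a} → ¬ A d → A a → ¬ Stab A d a → Crosses d ∣ a ∣
    ¬Stab⇒Crosses {d} {a} d∉A a∈A a∉Stab with em {Crosses d ∣ a ∣}
    ... | yes crosses = crosses
    ... | no ¬crosses with compare a 0#
    ...   | tri≈ _ refl _ = ⊥-elim (a∉Stab (0∈Stab d))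
    ...   | tri> _ _ 0<a  = ⊥-elim (a∉Stab (a∈A , ¬Crosses⇒ct-≐ˢ d∉A 0<a ¬crosses))
    ...   | tri< a<0 _ _  = ⊥-elim (a∉Stab (a∈A , swap ct[d]≐ct[d+a]))
      where
      ct[d]≐ct[d+a] : ct A d ≐ˢ ct A (d + a)
      ct[d]≐ct[d+a] = subst (λ y → ct A y ≐ˢ ct A (d + a)) (//-rightDividesʳ a d)
        (¬Crosses⇒ct-≐ˢ (+-∉ d∉A a∈A) (x<0⇒0<-x a<0) (¬Crosses-back d∉A a∈A ¬crosses))

    G-translate : ∀ {d a} → A a → ¬ A d → G A (d + a) ⊆ G A d
    G-translate {d} {a} a∈A d∉A x∈G = (λ d∈A → ⊥-elim (d∉A d∈A)) , λ _ b b∈A b∉Stab →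
      G⇒Within (+-∉ d∉A a∈A) x∈G (∣∣-closed b∈A)
        (Crosses-translate a∈A (¬Stab⇒Crosses d∉A b∈A b∉Stab))

    ¬G⇒Crosses-half : ∀ {d x} → ¬ A d → ¬ G A d x → ∃ λ h → A h × Crosses d h × ¬ Within (h + h) x
    ¬G⇒Crosses-half {d} {x} d∉A x∉G with em {∃ λ p → A p × Crosses d p × ¬ Within p x}
    ... | no ¬witness = ⊥-elim (x∉G ((λ d∈A → ⊥-elim (d∉A d∈A)) , λ _ a a∈A a∉Stab →
            em⇒dne em λ ¬within →
              ¬witness (∣ a ∣ , ∣∣-closed a∈A , ¬Stab⇒Crosses d∉A a∈A a∉Stab , ¬within)))
    ... | yes (p , p∈A , crosses-p , ¬within) with Crosses-halve p∈A crosses-p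
    ...   | h , h∈A , crosses-h , refl = h , h∈A , crosses-h , ¬within

    G-+-∉ : ∀ {d₁ d₂ x} → ¬ A d₁ → ¬ A d₂ → ¬ A (d₁ + d₂) →
            G A (d₁ + d₂) x → ¬ G A d₁ x → ¬ G A d₂ x → ⊥
    G-+-∉ {d₁} {d₂} {x} d₁∉A d₂∉A d₁+d₂∉A x∈G x∉G₁ x∉G₂
      with ¬G⇒Crosses-half d₁∉A x∉G₁ | ¬G⇒Crosses-half d₂∉A x∉G₂
    ... | h₁ , h₁∈A , crosses₁ , ¬within₁ | h₂ , h₂∈A , crosses₂ , ¬within₂ with compare h₁ h₂
    ...   | tri< h₁<h₂ _ _ =
      ¬within₂ (G-+⇒Within d₁+d₂∉A x∈G h₂∈A (Crosses-mono (inj₁ h₁<h₂) crosses₁) crosses₂)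
    ...   | tri≈ _ refl _  =
      ¬within₂ (G-+⇒Within d₁+d₂∉A x∈G h₂∈A crosses₁ crosses₂)
    ...   | tri> _ _ h₂<h₁ =
      ¬within₁ (G-+⇒Within d₁+d₂∉A x∈G h₁∈A crosses₁ (Crosses-mono (inj₁ h₂<h₁) crosses₂))

    G-+⊆G∪G : ∀ {d₁ d₂ x} → G A (d₁ + d₂) x → G A d₁ x ⊎ G A d₂ x
    G-+⊆G∪G {d₁} {d₂} {x} x∈G with em {A d₁} | em {A d₂}
    ... | yes d₁∈A | yes d₂∈A = inj₁ (subst (G A d₁) (sym (proj₁ x∈G (has-+ d₁∈A d₂∈A))) (0∈G d₁))
    ... | yes d₁∈A | no d₂∉A  =
      inj₂ (G-translate d₁∈A d₂∉A (subst (λ y → G A y x) (comm d₁ d₂) x∈G))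
    ... | no d₁∉A  | yes d₂∈A = inj₁ (G-translate d₂∈A d₁∉A x∈G)
    ... | no d₁∉A  | no d₂∉A with em {A (d₁ + d₂)}
    ...   | yes d₁+d₂∈A = inj₁ (subst (G A d₁) (sym (proj₁ x∈G d₁+d₂∈A)) (0∈G d₁))
    ...   | no d₁+d₂∉A with em {G A d₁ x} | em {G A d₂ x}
    ...     | yes x∈G₁ | _        = inj₁ x∈G₁
    ...     | no _     | yes x∈G₂ = inj₂ x∈G₂
    ...     | no x∉G₁  | no x∉G₂  = ⊥-elim (G-+-∉ d₁∉A d₂∉A d₁+d₂∉A x∈G x∉G₁ x∉G₂)

open DOAG using (Carrier; _+_)
open Semantics using (IsQSubspace; Saturated; StronglyHomogeneous; IsMaxIncl; G)

mainTheorem7 : ExcludedMiddle 0ℓ →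
    (M : DOAG) (A : Pred (Carrier M) 0ℓ) → IsQSubspace M A →
    Saturated M A → StronglyHomogeneous M A →
    ∀ (d₁ d₂ : Carrier M) (Z : Pred (Carrier M) 0ℓ) →
    IsMaxIncl M (G M A d₁) (G M A d₂) Z →
    G M A (_+_ M d₁ d₂) ⊆ Z
mainTheorem7 em M A A-subspace _ _ d₁ d₂ Z (_ , G₁⊆Z , G₂⊆Z) x∈G =
  [ G₁⊆Z , G₂⊆Z ]′ (Cuts.Classical.G-+⊆G∪G M A A-subspace em x∈G)
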